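{- Let $n\geq 1$ and let $G$ be a path $P_n$ with vertices $v_1,\dots,v_n$ (in order), each colored either $A$ or $B$. For indices $i,j$, let $P_{i,j}$, $X_{i,j}$, $Y_{i,j}$, $Z_{i,j}$ denote the games (combinatorial game values) defined below. Then $P_{i,j}=0$ if $i>j$; $X_{i,j}=Y_{i,j}=0$ if $i\geq j$; and $Z_{i,j}=0$ if $i\geq j-1$. Otherwise, $P_{i,j}=\{\mathcal{P}^A_{i,j}\mid\mathcal{P}^B_{i,j}\}$, $X_{i,j}=\{\mathcal{X}^A_{i,j}\mid\mathcal{X}^B_{i,j}\}$, $Y_{i,j}=\{\mathcal{Y}^A_{i,j}\mid\mathcal{Y}^B_{i,j}\}$ and $Z_{i,j}=\{\mathcal{Z}^A_{i,j}\mid\mathcal{Z}^B_{i,j}\}$, where, for $C\in\{A,B\}$: \[\mathcal{P}^C_{i,j}=\{Y_{i,k-1}+X_{k+1,j}:\ i\leq k\leq j \text{ and } v_k \text{ is colored } C\},\] \[\mathcal{X}^C_{i,j}=\{Z_{i,k-1}+X_{k+1,j}:\ i\leq k\leq j \text{ and } v_k \text{ is colored } C\},\] \[\mathcal{Y}^C_{i,j}=\{Y_{i,k-1}+Z_{k+1,j}:\ i\leq k\leq j \text{ and } v_k \text{ is colored } C\},\] \[\mathcal{Z}^C_{i,j}=\{Z_{i,k-1}+Z_{k+1,j}:\ i\leq k\leq j \text{ and } v_k \text{ is colored } C\}.\]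
   Context: \textsc{Normal Partizan Domination Game}: on a graph whose vertices are colored $A$ or $B$, Alice may only select vertices colored $A$ and Bob only vertices colored $B$; a selected vertex must be playable, i.e., dominate (itself or a neighbor) at least one vertex that still needs to be dominated and is not dominated by previously selected vertices; the last player to move wins. Games are treated in Conway's combinatorial game theory: a game is written $\{\mathcal{L}\mid\mathcal{R}\}$ where $\mathcal{L}$ (resp. $\mathcal{R}$) is the set of games reachable by one move of Alice (resp. Bob); $0=\{\,\mid\,\}$ is the game with no moves; $J_1+J_2$ is the disjoint sum (a player moves in exactly one component). For the colored path $v_1,\dots,v_n$: $P_{i,j}$ is the game on the subpath $v_i,\dots,v_j$ in which all its vertices must be dominated; $X_{i,j}$ is the same game on $v_i,\dots,v_j$ except that $v_i$ is already dominated (it need not be dominated but may still be selected to dominate other vertices); $Y_{i,j}$ is the same with $v_j$ already dominated instead; $Z_{i,j}$ is the same with both $v_i$ and $v_j$ already dominated. -}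

module Defs where

open import Data.Nat using (ℕ; zero; suc; _+_; _∸_; _<?_; _≡ᵇ_; _≤ᵇ_)
open import Data.Fin using (Fin; splitAt; fromℕ<)
open import Data.Bool using (Bool; true; false; _∧_; _∨_; not)
open import Data.Sum using ([_,_]′)
open import Data.Product using (Σ; _×_; _,_)
open import Data.Sum using (_⊎_)
open import Data.List using (List; length; lookup; map; filterᵇ; upTo)
open import Data.Bool.ListAction using (any)
open import Data.Maybe using (Maybe; just; nothing)
open import Relation.Nullary using (yes; no)

data Game : Set where
  mk : (m : ℕ) → (Fin m → Game) → (n : ℕ) → (Fin n → Game) → Game

zeroG : Game
zeroG = mk 0 (λ ()) 0 (λ ())

⟨_∣_⟩ : List Game → List Game → Game
⟨ Ls ∣ Rs ⟩ = mk (length Ls) (lookup Ls) (length Rs) (lookup Rs)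

infixl 6 _+G_
_+G_ : Game → Game → Game
G@(mk m l n r) +G H@(mk m' l' n' r') =
  mk (m + m') (λ x → [ (λ a → l a +G H) , (λ b → G +G l' b) ]′ (splitAt m x))
     (n + n') (λ x → [ (λ a → r a +G H) , (λ b → G +G r' b) ]′ (splitAt n x))

-- Conway's order:  G ≤ H  iff no G^L with H ≤ G^L and no H^R with H^R ≤ G;
-- stated positively via the mutually defined relation G ⧏ H (= not H ≤ G).
infix 4 _≤G_ _⧏G_ _≈G_
_≤G_ : Game → Game → Set
_⧏G_ : Game → Game → Set
mk m l n r ≤G mk m' l' n' r' =
  ((a : Fin m) → l a ⧏G mk m' l' n' r') × ((b : Fin n') → mk m l n r ⧏G r' b)
mk m l n r ⧏G mk m' l' n' r' =
  (Σ (Fin m') λ a → mk m l n r ≤G l' a) ⊎ (Σ (Fin n) λ b → r b ≤G mk m' l' n' r')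

_≈G_ : Game → Game → Set
G ≈G H = (G ≤G H) × (H ≤G G)

data Color : Set where
  A B : Color

_==ᶜ_ : Color → Color → Bool
A ==ᶜ A = true
B ==ᶜ B = true
_ ==ᶜ _ = false

-- Coloring of the path v_1,…,v_n given as  c : Fin n → Color  (v_k ↦ c (k-1)).
-- hasColor c k C  is true iff 1 ≤ k ≤ n and v_k has color C.
hasColor : ∀ {n} → (Fin n → Color) → ℕ → Color → Bool
hasColor c zero C = false
hasColor {n} c (suc k) C with k <? n
... | yes p = c (fromℕ< p) ==ᶜ C
... | no _  = false

range : ℕ → ℕ → List ℕ
range i j = map (i +_) (upTo (suc j ∸ i))

closedNb : ℕ → ℕ → Bool
closedNb k u = (u ≡ᵇ k) ∨ (u ≡ᵇ suc k) ∨ (suc u ≡ᵇ k)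

-- Normal partizan domination game on the subpath v_i,…,v_j.
-- A position is described by  need : ℕ → Bool , where need u (for i ≤ u ≤ j)
-- says that v_u still has to be dominated.  The extra argument is fuel: every move dominates at least
-- one new vertex, so  suc j ∸ i  (number of vertices) is always enough.

module DomGame {n : ℕ} (c : Fin n → Color) (i j : ℕ) where

  playable : (ℕ → Bool) → ℕ → Bool
  playable need k = any (λ u → closedNb k u ∧ need u) (range i j)

  moves : Color → (ℕ → Bool) → List ℕ
  moves C need = filterᵇ (λ k → hasColor c k C ∧ playable need k) (range i j)

  play : ℕ → (ℕ → Bool) → (ℕ → Bool)
  play k need u = need u ∧ not (closedNb k u)

  gameF : ℕ → (ℕ → Bool) → Game
  gameF zero need = zeroG
  gameF (suc f) need =
    ⟨ map (λ k → gameF f (play k need)) (moves A need)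
    ∣ map (λ k → gameF f (play k need)) (moves B need) ⟩

  game : (ℕ → Bool) → Game
  game need = gameF (suc j ∸ i) need

Pg Xg Yg Zg : ∀ {n} → (Fin n → Color) → ℕ → ℕ → Game
Pg c i j = DomGame.game c i j (λ u → true)
Xg c i j = DomGame.game c i j (λ u → not (u ≡ᵇ i))
Yg c i j = DomGame.game c i j (λ u → not (u ≡ᵇ j))
Zg c i j = DomGame.game c i j (λ u → not (u ≡ᵇ i) ∧ not (u ≡ᵇ j))

colored : ∀ {n} → (Fin n → Color) → Color → ℕ → ℕ → List ℕ
colored c C i j = filterᵇ (λ k → hasColor c k C) (range i j)

𝒫 𝒳 𝒴 𝒵 : ∀ {n} → (Fin n → Color) → Color → ℕ → ℕ → List Game
𝒫 c C i j = map (λ k → Yg c i (k ∸ 1) +G Xg c (suc k) j) (colored c C i j)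
𝒳 c C i j = map (λ k → Zg c i (k ∸ 1) +G Xg c (suc k) j) (colored c C i j)
𝒴 c C i j = map (λ k → Yg c i (k ∸ 1) +G Zg c (suc k) j) (colored c C i j)
𝒵 c C i j = map (λ k → Zg c i (k ∸ 1) +G Zg c (suc k) j) (colored c C i j)

{-# OPTIONS --safe #-}
-- Selecting v_k dominates v_{k-1}, v_k and v_{k+1}. From then on v_k is never playable again
-- and no vertex left of v_k dominates anything right of it or conversely, so the game splits
-- into the disjoint sum of the games on v_i … v_{k-1} and v_{k+1} … v_j, in each of which the
-- end next to v_k is already dominated. We prove the splitting as an isomorphism of game trees
-- (options matched up to reindexing, _≅_), which implies equality of values. When the subpath
-- is long enough every vertex still dominates something, so every vertex of a player's color
-- is one of their options; otherwise nothing is left to dominate and the game has no options.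
module Submission where

open import Defs
open import Data.Bool using (Bool; true; false; T; not; _∧_)
open import Data.Bool.Properties
  using (T-∧; T-∨; T-≡; T-not-≡; ¬-not; T?; ∨-identityʳ; ∧-identityʳ; ∧-comm)
open import Data.Nat using (ℕ; zero; suc; _+_; _∸_; _≤_; _<_; _>_; _≥_; _≡ᵇ_; s≤s; s≤s⁻¹; _≟_)
open import Data.Nat.Properties
open import Data.Fin using (Fin; splitAt; _↑ˡ_; _↑ʳ_)
open import Data.Fin.Properties using (splitAt-↑ˡ; splitAt-↑ʳ)
open import Data.Product using (_×_; _,_; ∃-syntax; ∃₂; proj₁; proj₂)
open import Data.Sum using (_⊎_; inj₁; inj₂; [_,_]′)
import Data.Sum as Sum
open import Data.List using (List; []; _∷_; length; map; filterᵇ; upTo)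
open import Data.List.Properties using (length-map; length-upTo; length-filter; filter-notAll)
open import Data.List.Membership.Propositional using (_∈_; find; lose)
open import Data.List.Membership.Propositional.Properties
  using (∈-lookup; ∈-map⁺; ∈-map⁻; ∈-upTo⁺; ∈-upTo⁻; ∈-filter⁺; ∈-filter⁻)
open import Data.List.Relation.Unary.Any using (index)
open import Data.List.Relation.Unary.Any.Properties using (lookup-index; any⁺; any⁻)
open import Function using (_∘_; _⇔_; mk⇔; Equivalence)
open import Relation.Binary.PropositionalEquality
open import Relation.Binary.Definitions using (tri<; tri≈; tri>)
open import Relation.Nullary using (¬_; contradiction; yes; no)

open Equivalence using (to; from)

data Side : Set where
  left right : Side

colorOf : Side → Color
colorOf left  = A
colorOf right = B

Option : Side → Game → Game → Set
Option left  (mk _ l _ _) x = ∃[ a ] l a ≡ x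
Option right (mk _ _ _ r) x = ∃[ b ] r b ≡ x

infix 4 _≅_
_≅_ : Game → Game → Set
mk _ l _ r ≅ mk _ l′ _ r′ =
  (∀ a → ∃[ a′ ] l a ≅ l′ a′) × (∀ a′ → ∃[ a ] l a ≅ l′ a′) ×
  (∀ b → ∃[ b′ ] r b ≅ r′ b′) × (∀ b′ → ∃[ b ] r b ≅ r′ b′)

≅-sym : ∀ {G H} → G ≅ H → H ≅ G
≅-sym {mk _ _ _ _} {mk _ _ _ _} (fl , bl , fr , br) =
  (λ a′ → let a , e = bl a′ in a , ≅-sym e) , (λ a → let a′ , e = fl a in a′ , ≅-sym e) ,
  (λ b′ → let b , e = br b′ in b , ≅-sym e) , (λ b → let b′ , e = fr b in b′ , ≅-sym e)

⧏G-intro-left : ∀ G {m l n r} a → G ≤G l a → G ⧏G mk m l n r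
⧏G-intro-left (mk _ _ _ _) a G≤Hᴸ = inj₁ (a , G≤Hᴸ)

⧏G-intro-right : ∀ {m l n r} H b → r b ≤G H → mk m l n r ⧏G H
⧏G-intro-right (mk _ _ _ _) b Gᴿ≤H = inj₂ (b , Gᴿ≤H)

≅⇒≤G : ∀ {G H} → G ≅ H → G ≤G H
≅⇒≤G {mk _ l _ _} {mk _ _ _ r′} (fl , _ , _ , br) =
  (λ a → let a′ , e = fl a in ⧏G-intro-left (l a) a′ (≅⇒≤G e)) ,
  (λ b′ → let b , e = br b′ in ⧏G-intro-right (r′ b′) b (≅⇒≤G e))

≅⇒≈G : ∀ {G H} → G ≅ H → G ≈G H
≅⇒≈G e = ≅⇒≤G e , ≅⇒≤G (≅-sym e)

Forth Back : Game → Game → Set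
Forth G H = ∀ s {x} → Option s G x → ∃[ y ] Option s H y × x ≅ y
Back  G H = ∀ s {y} → Option s H y → ∃[ x ] Option s G x × x ≅ y

≅-intro : ∀ {G H} → Forth G H → Back G H → G ≅ H
≅-intro {mk _ l _ r} {mk _ l′ _ r′} forth back =
  (λ a → target (forth left (a , refl))) , (λ a′ → source (back left (a′ , refl))) ,
  (λ b → target (forth right (b , refl))) , (λ b′ → source (back right (b′ , refl)))
  where
  target : ∀ {k} {g : Fin k → Game} {x} → ∃[ y ] (∃[ a ] g a ≡ y) × x ≅ y → ∃[ a ] x ≅ g a
  target (_ , (a , refl) , e) = a , e
  source : ∀ {k} {g : Fin k → Game} {y} → ∃[ x ] (∃[ a ] g a ≡ x) × x ≅ y → ∃[ a ] g a ≅ y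
  source (_ , (a , refl) , e) = a , e

+G-option⁻ : ∀ s G H {x} → Option s (G +G H) x →
  (∃[ g ] Option s G g × x ≡ g +G H) ⊎ (∃[ h ] Option s H h × x ≡ G +G h)
+G-option⁻ left (mk m l _ _) (mk _ l′ _ _) (a , refl) with splitAt m a
... | inj₁ a₁ = inj₁ (l a₁ , (a₁ , refl) , refl)
... | inj₂ a₂ = inj₂ (l′ a₂ , (a₂ , refl) , refl)
+G-option⁻ right (mk _ _ n r) (mk _ _ _ r′) (b , refl) with splitAt n b
... | inj₁ b₁ = inj₁ (r b₁ , (b₁ , refl) , refl)
... | inj₂ b₂ = inj₂ (r′ b₂ , (b₂ , refl) , refl)

+G-optionˡ : ∀ s G H {g} → Option s G g → Option s (G +G H) (g +G H)
+G-optionˡ left  (mk m _ _ _) (mk m′ _ _ _) (a , refl) = a ↑ˡ m′ , cong [ _ , _ ]′ (splitAt-↑ˡ m a m′)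
+G-optionˡ right (mk _ _ n _) (mk _ _ n′ _) (b , refl) = b ↑ˡ n′ , cong [ _ , _ ]′ (splitAt-↑ˡ n b n′)

+G-optionʳ : ∀ s G H {h} → Option s H h → Option s (G +G H) (G +G h)
+G-optionʳ left  (mk m _ _ _) (mk m′ _ _ _) (a , refl) = m ↑ʳ a , cong [ _ , _ ]′ (splitAt-↑ʳ m m′ a)
+G-optionʳ right (mk _ _ n _) (mk _ _ n′ _) (b , refl) = n ↑ʳ b , cong [ _ , _ ]′ (splitAt-↑ʳ n n′ b)

⟨∣⟩-option⁻ : ∀ s (xs : Color → List ℕ) (F : ℕ → Game) {y} →
  Option s ⟨ map F (xs A) ∣ map F (xs B) ⟩ y → ∃[ k ] k ∈ xs (colorOf s) × y ≡ F k
⟨∣⟩-option⁻ left  xs F (a , refl) = ∈-map⁻ F (∈-lookup a)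
⟨∣⟩-option⁻ right xs F (b , refl) = ∈-map⁻ F (∈-lookup b)

⟨∣⟩-option⁺ : ∀ s (xs : Color → List ℕ) (F : ℕ → Game) {k} →
  k ∈ xs (colorOf s) → Option s ⟨ map F (xs A) ∣ map F (xs B) ⟩ (F k)
⟨∣⟩-option⁺ left  xs F k∈ = index (∈-map⁺ F k∈) , sym (lookup-index (∈-map⁺ F k∈))
⟨∣⟩-option⁺ right xs F k∈ = index (∈-map⁺ F k∈) , sym (lookup-index (∈-map⁺ F k∈))

T-not⇒¬T : ∀ {b} → T (not b) → ¬ T b
T-not⇒¬T {false} _ ()

≢⇒≡ᵇ≡false : ∀ {m n} → m ≢ n → (m ≡ᵇ n) ≡ false
≢⇒≡ᵇ≡false {m} {n} m≢n = ¬-not (m≢n ∘ ≡ᵇ⇒≡ m n ∘ from T-≡)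

T-not-≡ᵇ : ∀ {m n} → T (not (m ≡ᵇ n)) ⇔ m ≢ n
T-not-≡ᵇ {m} {n} = mk⇔
  (λ { t refl → T-not⇒¬T t (≡⇒≡ᵇ m m refl) })
  (from T-not-≡ ∘ ≢⇒≡ᵇ≡false)

filterᵇ-∧ : ∀ {A : Set} (p q : A → Bool) xs →
  filterᵇ (λ u → p u ∧ q u) xs ≡ filterᵇ q (filterᵇ p xs)
filterᵇ-∧ p q [] = refl
filterᵇ-∧ p q (x ∷ xs) with p x
... | false = filterᵇ-∧ p q xs
... | true with q x
...   | false = filterᵇ-∧ p q xs
...   | true  = cong (x ∷_) (filterᵇ-∧ p q xs)

length-filterᵇ-∧-< : ∀ {A : Set} (p q : A → Bool) {xs u} → u ∈ xs → T (p u) → ¬ T (q u) →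
  length (filterᵇ (λ v → p v ∧ q v) xs) < length (filterᵇ p xs)
length-filterᵇ-∧-< p q {xs} u∈xs pu ¬qu rewrite filterᵇ-∧ p q xs =
  filter-notAll (T? ∘ q) (filterᵇ p xs) (lose (∈-filter⁺ (T? ∘ p) u∈xs pu) ¬qu)

m<1+n∸o⇒o+m≤n : ∀ o {m n} → m < suc n ∸ o → o + m ≤ n
m<1+n∸o⇒o+m≤n zero                m<1+n = s≤s⁻¹ m<1+n
m<1+n∸o⇒o+m≤n (suc o) {n = zero}  m<0   rewrite 0∸n≡0 o = contradiction m<0 n≮0
m<1+n∸o⇒o+m≤n (suc o) {n = suc n} m<    = s≤s (m<1+n∸o⇒o+m≤n o m<)

∈-range⁻ : ∀ {i j k} → k ∈ range i j → i ≤ k × k ≤ j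
∈-range⁻ {i} k∈ with ∈-map⁻ (i +_) k∈
... | x , x∈ , refl = m≤m+n i x , m<1+n∸o⇒o+m≤n i (∈-upTo⁻ x∈)

∈-range⁺ : ∀ {i j k} → i ≤ k → k ≤ j → k ∈ range i j
∈-range⁺ {i} {j} i≤k k≤j = subst (_∈ range i j) (m+[n∸m]≡n i≤k)
  (∈-map⁺ (i +_) (∈-upTo⁺ (∸-monoˡ-< (s≤s k≤j) i≤k)))

length-range : ∀ i j → length (range i j) ≡ suc j ∸ i
length-range i j = trans (length-map (i +_) (upTo (suc j ∸ i))) (length-upTo (suc j ∸ i))

T-closedNb : ∀ {k u} → T (closedNb k u) ⇔ (u ≡ k ⊎ u ≡ suc k ⊎ suc u ≡ k)
T-closedNb {k} {u} = mk⇔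
  (Sum.map (≡ᵇ⇒≡ u k) (Sum.map (≡ᵇ⇒≡ u (suc k)) (≡ᵇ⇒≡ (suc u) k) ∘ to T-∨) ∘ to T-∨)
  (from T-∨ ∘ Sum.map (≡⇒≡ᵇ u k) (from T-∨ ∘ Sum.map (≡⇒≡ᵇ u (suc k)) (≡⇒≡ᵇ (suc u) k)))

closedNb-refl : ∀ k → T (closedNb k k)
closedNb-refl k = from (T-closedNb {k} {k}) (inj₁ refl)

closedNb-suc : ∀ k → T (closedNb k (suc k))
closedNb-suc k = from (T-closedNb {k} {suc k}) (inj₂ (inj₁ refl))

closedNb-pred : ∀ k → T (closedNb (suc k) k)
closedNb-pred k = from (T-closedNb {suc k} {k}) (inj₂ (inj₂ refl))

closedNb-near : ∀ {k u} → T (closedNb k u) → u ≤ suc k × k ≤ suc u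
closedNb-near {k} {u} adj with to (T-closedNb {k} {u}) adj
... | inj₁ refl        = n≤1+n u , n≤1+n u
... | inj₂ (inj₁ refl) = ≤-refl , m≤n⇒m≤1+n (n≤1+n k)
... | inj₂ (inj₂ refl) = m≤n⇒m≤1+n (n≤1+n u) , ≤-refl

closedNb-below : ∀ {k u} → u < k → closedNb k u ≡ (suc u ≡ᵇ k)
closedNb-below {k} {u} u<k
  rewrite ≢⇒≡ᵇ≡false (<⇒≢ u<k) | ≢⇒≡ᵇ≡false (<⇒≢ (m≤n⇒m≤1+n u<k)) = refl

closedNb-above : ∀ {k u} → k < u → closedNb k u ≡ (u ≡ᵇ suc k)
closedNb-above {k} {u} k<u
  rewrite ≢⇒≡ᵇ≡false (>⇒≢ k<u) | ≢⇒≡ᵇ≡false (>⇒≢ (m≤n⇒m≤1+n k<u)) = ∨-identityʳ (u ≡ᵇ suc k)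

module PathGame {n} (c : Fin n → Color) (i j : ℕ) where
  open DomGame c i j public

  InRange : ℕ → Set
  InRange u = i ≤ u × u ≤ j

  Playable : (ℕ → Bool) → ℕ → Set
  Playable need k = ∃[ u ] InRange u × T (closedNb k u) × T (need u)

  Legal : Side → (ℕ → Bool) → ℕ → Set
  Legal s need k = InRange k × T (hasColor c k (colorOf s)) × Playable need k

  remaining : (ℕ → Bool) → ℕ
  remaining need = length (filterᵇ need (range i j))

  remaining≤size : ∀ need → remaining need ≤ suc j ∸ i
  remaining≤size need =
    ≤-trans (length-filter (T? ∘ need) (range i j)) (≤-reflexive (length-range i j))

  remaining-play : ∀ {need k} → Playable need k → remaining (play k need) < remaining need
  remaining-play {need} {k} (u , (i≤u , u≤j) , adj , need-u) =
    length-filterᵇ-∧-< need (not ∘ closedNb k) (∈-range⁺ i≤u u≤j) need-u (λ t → T-not⇒¬T t adj)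

  remaining-play≤ : ∀ {need k f} → remaining need ≤ suc f → Playable need k →
    remaining (play k need) ≤ f
  remaining-play≤ bound pl = s≤s⁻¹ (<-≤-trans (remaining-play pl) bound)

  playable⁻ : ∀ {need k} → T (playable need k) → Playable need k
  playable⁻ t with find (any⁻ _ (range i j) t)
  ... | u , u∈ , adj-need = u , ∈-range⁻ u∈ , to T-∧ adj-need

  playable⁺ : ∀ {need k} → Playable need k → T (playable need k)
  playable⁺ (u , (i≤u , u≤j) , adj-need) = any⁺ _ (lose (∈-range⁺ i≤u u≤j) (from T-∧ adj-need))

  ∈-moves⁻ : ∀ s {need k} → k ∈ moves (colorOf s) need → Legal s need k
  ∈-moves⁻ s k∈ with ∈-filter⁻ (T? ∘ _) k∈
  ... | k∈range , t with to T-∧ t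
  ...   | ofColor , pl = ∈-range⁻ k∈range , ofColor , playable⁻ pl

  ∈-moves⁺ : ∀ s {need k} → Legal s need k → k ∈ moves (colorOf s) need
  ∈-moves⁺ s ((i≤k , k≤j) , ofColor , pl) =
    ∈-filter⁺ (T? ∘ _) (∈-range⁺ i≤k k≤j) (from T-∧ (ofColor , playable⁺ pl))

  gameF-option⁻ : ∀ s {f need x} → remaining need ≤ f → Option s (gameF f need) x →
    ∃₂ λ k f′ → f ≡ suc f′ × Legal s need k × remaining (play k need) ≤ f′ ×
                x ≡ gameF f′ (play k need)
  gameF-option⁻ left  {zero} _ (() , _)
  gameF-option⁻ right {zero} _ (() , _)
  gameF-option⁻ s {suc f} {need} bound o
    with ⟨∣⟩-option⁻ s (λ C → moves C need) (λ k → gameF f (play k need)) o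
  ... | k , k∈ , refl = k , f , refl , legal , remaining-play≤ bound (proj₂ (proj₂ legal)) , refl
    where legal = ∈-moves⁻ s k∈

  gameF-option⁺ : ∀ s {f need k} → remaining need ≤ f → Legal s need k →
    ∃[ f′ ] f ≡ suc f′ × remaining (play k need) ≤ f′ ×
            Option s (gameF f need) (gameF f′ (play k need))
  gameF-option⁺ s {zero} bound (_ , _ , pl) = contradiction (<-≤-trans (remaining-play pl) bound) n≮0
  gameF-option⁺ s {suc f} {need} {k} bound legal@(_ , _ , pl) =
    f , refl , remaining-play≤ bound pl ,
    ⟨∣⟩-option⁺ s (λ C → moves C need) (λ k → gameF f (play k need)) (∈-moves⁺ s legal)

  game-≅-zero : ∀ need → (∀ {u} → InRange u → ¬ T (need u)) → game need ≅ zeroG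
  game-≅-zero need unneeded = ≅-intro forth back
    where
    forth : Forth (game need) zeroG
    forth s o with gameF-option⁻ s (remaining≤size need) o
    ... | _ , _ , _ , (_ , _ , (_ , u∈ , _ , need-u)) , _ = contradiction need-u (unneeded u∈)
    back : Back (game need) zeroG
    back left  (() , _)
    back right (() , _)

  ∈-colored⁻ : ∀ {C k} → k ∈ colored c C i j → InRange k × T (hasColor c k C)
  ∈-colored⁻ k∈ with ∈-filter⁻ (T? ∘ _) k∈
  ... | k∈range , ofColor = ∈-range⁻ k∈range , ofColor

  ∈-colored⁺ : ∀ {C k} → InRange k → T (hasColor c k C) → k ∈ colored c C i j
  ∈-colored⁺ (i≤k , k≤j) = ∈-filter⁺ (T? ∘ _) (∈-range⁺ i≤k k≤j)

  game-≅-⟨∣⟩ : ∀ need (F : ℕ → Game) → (∀ {k} → InRange k → Playable need k) →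
    (∀ {k f} → InRange k → remaining (play k need) ≤ f → gameF f (play k need) ≅ F k) →
    game need ≅ ⟨ map F (colored c A i j) ∣ map F (colored c B i j) ⟩
  game-≅-⟨∣⟩ need F playable-all after = ≅-intro forth back
    where
    forth : Forth (game need) ⟨ map F (colored c A i j) ∣ map F (colored c B i j) ⟩
    forth s o with gameF-option⁻ s (remaining≤size need) o
    ... | k , _ , _ , (k∈ , ofColor , _) , bound , refl =
      F k , ⟨∣⟩-option⁺ s (λ C → colored c C i j) F (∈-colored⁺ k∈ ofColor) , after k∈ bound
    back : Back (game need) ⟨ map F (colored c A i j) ∣ map F (colored c B i j) ⟩
    back s o with ⟨∣⟩-option⁻ s (λ C → colored c C i j) F o
    ... | k , k∈ , refl with ∈-colored⁻ k∈
    ...   | k∈range , ofColor =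
      let _ , _ , bound , o′ =
            gameF-option⁺ s (remaining≤size need) (k∈range , ofColor , playable-all k∈range)
      in _ , o′ , after k∈range bound

AgreeOn : ℕ → ℕ → (ℕ → Bool) → (ℕ → Bool) → Set
AgreeOn a b p q = ∀ {u} → a ≤ u → u ≤ b → p u ≡ q u

module Split {n} (c : Fin n → Color) {i m j} (i≤k : i ≤ suc m) (k≤j : suc m ≤ j) where
  module Whole = PathGame c i j
  module Left  = PathGame c i m
  module Right = PathGame c (suc (suc m)) j
  open Whole using (play; remaining; gameF)

  CutDominated : (ℕ → Bool) → Set
  CutDominated need = ∀ {u} → Whole.InRange u → T (closedNb (suc m) u) → ¬ T (need u)

  -- The fuel of a game tree only has to cover the vertices still to be dominated,
  -- since every move dominates at least one of them.
  Splits : ℕ → Set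
  Splits f = ∀ {f₁ f₂ need need₁ need₂} →
    CutDominated need → AgreeOn i m need need₁ → AgreeOn (suc (suc m)) j need need₂ →
    remaining need ≤ f → Left.remaining need₁ ≤ f₁ → Right.remaining need₂ ≤ f₂ →
    gameF f need ≅ Left.gameF f₁ need₁ +G Right.gameF f₂ need₂

  cut-play : ∀ {need} k → CutDominated need → CutDominated (play k need)
  cut-play _ cut u∈ adj = cut u∈ adj ∘ proj₁ ∘ to T-∧

  agree-play : ∀ {a b p q} k → AgreeOn a b p q → AgreeOn a b (play k p) (play k q)
  agree-play k agree {u} a≤u u≤b = cong (_∧ not (closedNb k u)) (agree a≤u u≤b)

  agree-play-far : ∀ {a b p q} k → (∀ {u} → a ≤ u → u ≤ b → ¬ T (closedNb k u)) →
    AgreeOn a b p q → AgreeOn a b (play k p) q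
  agree-play-far {p = p} k far agree {u} a≤u u≤b with closedNb k u in adj
  ... | true  = contradiction (subst T (sym adj) _) (far a≤u u≤b)
  ... | false = trans (∧-identityʳ (p u)) (agree a≤u u≤b)

  left-far-from-right : ∀ {k u} → k ≤ m → suc (suc m) ≤ u → ¬ T (closedNb k u)
  left-far-from-right k≤m m+2≤u adj = <⇒≱ (≤-trans m+2≤u (proj₁ (closedNb-near adj))) (s≤s k≤m)

  right-far-from-left : ∀ {k u} → suc (suc m) ≤ k → u ≤ m → ¬ T (closedNb k u)
  right-far-from-left m+2≤k u≤m adj = <⇒≱ (≤-trans m+2≤k (proj₂ (closedNb-near adj))) (s≤s u≤m)

  m≤j : m ≤ j
  m≤j = ≤-trans (n≤1+n m) k≤j

  i≤m+2 : i ≤ suc (suc m)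
  i≤m+2 = m≤n⇒m≤1+n i≤k

  needed-≢-cut : ∀ {need u} → CutDominated need → Whole.InRange u → T (need u) → u ≢ suc m
  needed-≢-cut cut u∈ need-u refl = cut u∈ (closedNb-refl (suc m)) need-u

  playable-restrictˡ : ∀ {need need₁ k} → CutDominated need → AgreeOn i m need need₁ → k ≤ m →
    Whole.Playable need k → Left.Playable need₁ k
  playable-restrictˡ cut agree k≤m (u , u∈@(i≤u , _) , adj , need-u) =
    u , (i≤u , u≤m) , adj , subst T (agree i≤u u≤m) need-u
    where
    u≤m : u ≤ m
    u≤m = s≤s⁻¹ (≤∧≢⇒< (≤-trans (proj₁ (closedNb-near adj)) (s≤s k≤m)) (needed-≢-cut cut u∈ need-u))

  playable-restrictʳ : ∀ {need need₂ k} → CutDominated need → AgreeOn (suc (suc m)) j need need₂ →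
    suc (suc m) ≤ k → Whole.Playable need k → Right.Playable need₂ k
  playable-restrictʳ cut agree m+2≤k (u , u∈@(_ , u≤j) , adj , need-u) =
    u , (m+2≤u , u≤j) , adj , subst T (agree m+2≤u u≤j) need-u
    where
    m+2≤u : suc (suc m) ≤ u
    m+2≤u = ≤∧≢⇒< (s≤s⁻¹ (≤-trans m+2≤k (proj₂ (closedNb-near adj))))
                  (≢-sym (needed-≢-cut cut u∈ need-u))

  playable-extendˡ : ∀ {need need₁ k} → AgreeOn i m need need₁ →
    Left.Playable need₁ k → Whole.Playable need k
  playable-extendˡ agree (u , (i≤u , u≤m) , adj , need₁-u) =
    u , (i≤u , ≤-trans u≤m m≤j) , adj , subst T (sym (agree i≤u u≤m)) need₁-u

  playable-extendʳ : ∀ {need need₂ k} → AgreeOn (suc (suc m)) j need need₂ →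
    Right.Playable need₂ k → Whole.Playable need k
  playable-extendʳ agree (u , (m+2≤u , u≤j) , adj , need₂-u) =
    u , (≤-trans i≤m+2 m+2≤u , u≤j) , adj , subst T (sym (agree m+2≤u u≤j)) need₂-u

  splits-step : ∀ {f} → (∀ {f′} → f ≡ suc f′ → Splits f′) → Splits f
  splits-step {f} IH {f₁} {f₂} {need} {need₁} {need₂} cut agree₁ agree₂ fuel fuel₁ fuel₂ =
    ≅-intro forth back
    where
    G₁ = Left.gameF f₁ need₁
    G₂ = Right.gameF f₂ need₂

    after-left : ∀ {k f′ f₁′} → f ≡ suc f′ → k ≤ m →
      remaining (play k need) ≤ f′ → Left.remaining (play k need₁) ≤ f₁′ →
      gameF f′ (play k need) ≅ Left.gameF f₁′ (play k need₁) +G G₂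
    after-left {k} f≡ k≤m bound bound₁ =
      IH f≡ (cut-play k cut) (agree-play k agree₁)
        (agree-play-far k (λ m+2≤u _ → left-far-from-right k≤m m+2≤u) agree₂) bound bound₁ fuel₂

    after-right : ∀ {k f′ f₂′} → f ≡ suc f′ → suc (suc m) ≤ k →
      remaining (play k need) ≤ f′ → Right.remaining (play k need₂) ≤ f₂′ →
      gameF f′ (play k need) ≅ G₁ +G Right.gameF f₂′ (play k need₂)
    after-right {k} f≡ m+2≤k bound bound₂ =
      IH f≡ (cut-play k cut) (agree-play-far k (λ _ u≤m → right-far-from-left m+2≤k u≤m) agree₁)
        (agree-play k agree₂) bound fuel₁ bound₂

    forth : Forth (gameF f need) (G₁ +G G₂)
    forth s o with Whole.gameF-option⁻ s fuel o
    ... | k , _ , f≡ , ((i≤k , k≤j) , ofColor , pl) , bound , refl with <-cmp k (suc m)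
    ...   | tri≈ _ refl _ = let u , u∈ , adj , need-u = pl in contradiction need-u (cut u∈ adj)
    ...   | tri< k<m+1 _ _ =
      let k≤m = s≤s⁻¹ k<m+1
          _ , _ , bound₁ , o₁ =
            Left.gameF-option⁺ s fuel₁ ((i≤k , k≤m) , ofColor , playable-restrictˡ cut agree₁ k≤m pl)
      in _ , +G-optionˡ s G₁ G₂ o₁ , after-left f≡ k≤m bound bound₁
    ...   | tri> _ _ m+2≤k =
      let _ , _ , bound₂ , o₂ =
            Right.gameF-option⁺ s fuel₂ ((m+2≤k , k≤j) , ofColor , playable-restrictʳ cut agree₂ m+2≤k pl)
      in _ , +G-optionʳ s G₁ G₂ o₂ , after-right f≡ m+2≤k bound bound₂

    back : Back (gameF f need) (G₁ +G G₂)
    back s o with +G-option⁻ s G₁ G₂ o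
    ... | inj₁ (_ , o₁ , refl) with Left.gameF-option⁻ s fuel₁ o₁
    ...   | k , _ , _ , ((i≤k , k≤m) , ofColor , pl₁) , bound₁ , refl =
      let _ , f≡ , bound , o′ =
            Whole.gameF-option⁺ s fuel ((i≤k , ≤-trans k≤m m≤j) , ofColor , playable-extendˡ agree₁ pl₁)
      in _ , o′ , after-left f≡ k≤m bound bound₁
    back s o | inj₂ (_ , o₂ , refl) with Right.gameF-option⁻ s fuel₂ o₂
    ...   | k , _ , _ , ((m+2≤k , k≤j) , ofColor , pl₂) , bound₂ , refl =
      let _ , f≡ , bound , o′ =
            Whole.gameF-option⁺ s fuel ((≤-trans i≤m+2 m+2≤k , k≤j) , ofColor , playable-extendʳ agree₂ pl₂)
      in _ , o′ , after-right f≡ m+2≤k bound bound₂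

  splits : ∀ f → Splits f
  splits zero    = splits-step (λ ())
  splits (suc f) = splits-step (λ { refl → splits f })

-- Whether v_u must still be dominated when v_i (if dᵢ) and v_j (if dⱼ) already are; the four
-- clauses are, definitionally, the positions of Pg, Xg, Yg and Zg.
needed : Bool → Bool → ℕ → ℕ → ℕ → Bool
needed false false i j u = true
needed true  false i j u = not (u ≡ᵇ i)
needed false true  i j u = not (u ≡ᵇ j)
needed true  true  i j u = not (u ≡ᵇ i) ∧ not (u ≡ᵇ j)

dominatedEnds : Bool → Bool → ℕ
dominatedEnds false false = 0
dominatedEnds true  true  = 2
dominatedEnds _     _     = 1

pathGame : ∀ {n} → (Fin n → Color) → Bool → Bool → ℕ → ℕ → Game
pathGame c dᵢ dⱼ i j = DomGame.game c i j (needed dᵢ dⱼ i j)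

pathOptions : ∀ {n} → (Fin n → Color) → Bool → Bool → Color → ℕ → ℕ → List Game
pathOptions c dᵢ dⱼ C i j =
  map (λ k → pathGame c dᵢ true i (k ∸ 1) +G pathGame c true dⱼ (suc k) j) (colored c C i j)

nothing-needed : ∀ dᵢ dⱼ {i j u} → j < dominatedEnds dᵢ dⱼ + i → i ≤ u → u ≤ j →
  ¬ T (needed dᵢ dⱼ i j u)
nothing-needed false false j<i i≤u u≤j _ = <⇒≱ j<i (≤-trans i≤u u≤j)
nothing-needed true  false j<1+i i≤u u≤j t =
  to T-not-≡ᵇ t (≤-antisym (≤-trans u≤j (s≤s⁻¹ j<1+i)) i≤u)
nothing-needed false true  j<1+i i≤u u≤j t =
  to T-not-≡ᵇ t (≤-antisym u≤j (≤-trans (s≤s⁻¹ j<1+i) i≤u))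
nothing-needed true  true  j<2+i i≤u u≤j t =
  let tᵢ , tⱼ = to T-∧ t
      i<u = ≤∧≢⇒< i≤u (≢-sym (to T-not-≡ᵇ tᵢ))
  in to T-not-≡ᵇ tⱼ (≤-antisym u≤j (≤-trans (s≤s⁻¹ j<2+i) i<u))

module _ {n} (c : Fin n → Color) where
  open PathGame c using (InRange; Playable)

  every-vertex-playable : ∀ dᵢ dⱼ {i j k} → dominatedEnds dᵢ dⱼ + i ≤ j → InRange i j k →
    Playable i j (needed dᵢ dⱼ i j) k
  every-vertex-playable false false {k = k} _ k∈ = k , k∈ , closedNb-refl k , _
  every-vertex-playable true false {i} {k = k} i<j k∈ with k ≟ i
  ... | yes refl = suc k , (n≤1+n k , i<j) , closedNb-suc k , from T-not-≡ᵇ (1+n≢n {k})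
  ... | no k≢i   = k , k∈ , closedNb-refl k , from T-not-≡ᵇ k≢i
  every-vertex-playable false true {j = j} {k} i<j k∈ with k ≟ j
  every-vertex-playable false true {k = suc k} i<j _ | yes refl =
    k , (s≤s⁻¹ i<j , n≤1+n k) , closedNb-pred k , from T-not-≡ᵇ (<⇒≢ (n<1+n k))
  every-vertex-playable false true {k = zero} () _ | yes refl
  ... | no k≢j = k , k∈ , closedNb-refl k , from T-not-≡ᵇ k≢j
  every-vertex-playable true true {i} {j} {k} i+1<j k∈ with k ≟ i | k ≟ j
  ... | yes refl | _ = suc k , (n≤1+n k , <⇒≤ i+1<j) , closedNb-suc k ,
    from T-∧ (from T-not-≡ᵇ (1+n≢n {k}) , from T-not-≡ᵇ (<⇒≢ i+1<j))
  every-vertex-playable true true {k = suc k} i+1<j _ | no k≢i | yes refl =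
    k , (s≤s⁻¹ (<⇒≤ i+1<j) , n≤1+n k) , closedNb-pred k ,
    from T-∧ (from T-not-≡ᵇ (>⇒≢ (s≤s⁻¹ i+1<j)) , from T-not-≡ᵇ (<⇒≢ (n<1+n k)))
  every-vertex-playable true true {k = zero} () _ | no _ | yes refl
  ... | no k≢i | no k≢j =
    k , k∈ , closedNb-refl k , from T-∧ (from T-not-≡ᵇ k≢i , from T-not-≡ᵇ k≢j)

needed-left : ∀ dᵢ dⱼ {i j m u} → u < j → needed dᵢ dⱼ i j u ∧ not (u ≡ᵇ m) ≡ needed dᵢ true i m u
needed-left false false _ = refl
needed-left true  false _ = refl
needed-left false true  u<j rewrite ≢⇒≡ᵇ≡false (<⇒≢ u<j) = refl
needed-left true  true {i} {u = u} u<j rewrite ≢⇒≡ᵇ≡false (<⇒≢ u<j) =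
  cong (_∧ _) (∧-identityʳ (not (u ≡ᵇ i)))

needed-right : ∀ dᵢ dⱼ {i j m u} → i < u → needed dᵢ dⱼ i j u ∧ not (u ≡ᵇ m) ≡ needed true dⱼ m j u
needed-right false false _ = refl
needed-right true  false i<u rewrite ≢⇒≡ᵇ≡false (>⇒≢ i<u) = refl
needed-right false true  {j = j} {m} {u} _ = ∧-comm (not (u ≡ᵇ j)) (not (u ≡ᵇ m))
needed-right true  true  {j = j} {m} {u} i<u rewrite ≢⇒≡ᵇ≡false (>⇒≢ i<u) =
  ∧-comm (not (u ≡ᵇ j)) (not (u ≡ᵇ m))

pathGame-≅-zero : ∀ {n} (c : Fin n → Color) dᵢ dⱼ {i j} → j < dominatedEnds dᵢ dⱼ + i →
  pathGame c dᵢ dⱼ i j ≅ zeroG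
pathGame-≅-zero c dᵢ dⱼ {i} {j} short =
  PathGame.game-≅-zero c i j (needed dᵢ dⱼ i j)
    (λ (i≤u , u≤j) → nothing-needed dᵢ dⱼ short i≤u u≤j)

pathGame-≅-options : ∀ {n} (c : Fin n → Color) dᵢ dⱼ {i j} → 1 ≤ i →
  dominatedEnds dᵢ dⱼ + i ≤ j →
  pathGame c dᵢ dⱼ i j ≅ ⟨ pathOptions c dᵢ dⱼ A i j ∣ pathOptions c dᵢ dⱼ B i j ⟩
pathGame-≅-options c dᵢ dⱼ {i} {j} 1≤i long =
  game-≅-⟨∣⟩ need _ (every-vertex-playable c dᵢ dⱼ long) splits-after
  where
  open PathGame c i j
  need = needed dᵢ dⱼ i j

  splits-after : ∀ {k f} → InRange k → remaining (play k need) ≤ f →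
    gameF f (play k need) ≅ pathGame c dᵢ true i (k ∸ 1) +G pathGame c true dⱼ (suc k) j
  splits-after {zero} (i≤0 , _) _ = contradiction (≤-trans 1≤i i≤0) λ ()
  splits-after {suc m} (i≤k , k≤j) bound =
    Split.splits c i≤k k≤j _ cut agree-left agree-right bound
      (PathGame.remaining≤size c i m _) (PathGame.remaining≤size c (suc (suc m)) j _)
    where
    cut : ∀ {u} → InRange u → T (closedNb (suc m) u) → ¬ T (play (suc m) need u)
    cut _ adj t = T-not⇒¬T (proj₂ (to T-∧ t)) adj
    agree-left : AgreeOn i m (play (suc m) need) (needed dᵢ true i m)
    agree-left {u} _ u≤m = trans (cong (λ b → need u ∧ not b) (closedNb-below (s≤s u≤m)))
      (needed-left dᵢ dⱼ (<-≤-trans (s≤s u≤m) k≤j))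
    agree-right : AgreeOn (suc (suc m)) j (play (suc m) need) (needed true dⱼ (suc (suc m)) j)
    agree-right {u} m+2≤u _ = trans (cong (λ b → need u ∧ not b) (closedNb-above m+2≤u))
      (needed-right dᵢ dⱼ (<-≤-trans (s≤s i≤k) m+2≤u))

lemma3 : (n : ℕ) → 1 ≤ n → (c : Fin n → Color) → (i j : ℕ) → 1 ≤ i → j ≤ n →
    ((i > j → Pg c i j ≈G zeroG) × (i ≤ j → Pg c i j ≈G ⟨ 𝒫 c A i j ∣ 𝒫 c B i j ⟩))
    × ((i ≥ j → Xg c i j ≈G zeroG) × (i < j → Xg c i j ≈G ⟨ 𝒳 c A i j ∣ 𝒳 c B i j ⟩))
    × ((i ≥ j → Yg c i j ≈G zeroG) × (i < j → Yg c i j ≈G ⟨ 𝒴 c A i j ∣ 𝒴 c B i j ⟩))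
    × ((suc i ≥ j → Zg c i j ≈G zeroG) × (suc i < j → Zg c i j ≈G ⟨ 𝒵 c A i j ∣ 𝒵 c B i j ⟩))
lemma3 n _ c i j 1≤i _ =
    (zero-when false false , options-when false false)
  , (zero-when true false ∘ s≤s , options-when true false)
  , (zero-when false true ∘ s≤s , options-when false true)
  , (zero-when true true ∘ s≤s , options-when true true)
  where
  zero-when : ∀ dᵢ dⱼ → j < dominatedEnds dᵢ dⱼ + i → pathGame c dᵢ dⱼ i j ≈G zeroG
  zero-when dᵢ dⱼ = ≅⇒≈G ∘ pathGame-≅-zero c dᵢ dⱼ
  options-when : ∀ dᵢ dⱼ → dominatedEnds dᵢ dⱼ + i ≤ j →
    pathGame c dᵢ dⱼ i j ≈G ⟨ pathOptions c dᵢ dⱼ A i j ∣ pathOptions c dᵢ dⱼ B i j ⟩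
  options-when dᵢ dⱼ = ≅⇒≈G ∘ pathGame-≅-options c dᵢ dⱼ 1≤i
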